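{- Let $\mathbb{F}_q$ be a finite field, $r$ a prime divisor of $q-1$, and $\beta\in\mathbb{F}_q^\times$ an $r$-th power in $\mathbb{F}_q$. Let $f(x)\in\mathbb{F}_q[x]$ be a monic non-trivial factor of $x^r-\beta$ (i.e. $0<n:=\deg f<r$), let $c_0$ be the constant term of $f$, and let $u,v$ be integers with $un+vr=1$. Then $\big((-1)^{nu}c_0^u\beta^v\big)^r=\beta$, i.e. $(-1)^{nu}c_0^u\beta^v$ is an $r$-th root of $\beta$. -}

module Defs where

open import Level using (Level; _⊔_)
open import Data.Nat as ℕ using (ℕ; zero; suc)
open import Data.Fin using (Fin)
open import Data.Integer as ℤ using (ℤ; +_; -[1+_])
open import Data.List using (List; []; _∷_; replicate; _++_)
open import Data.Product using (∃)
open import Relation.Binary.PropositionalEquality using (_≡_)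
open import Relation.Nullary using (¬_)
open import Algebra.Bundles using (CommutativeRing)

-- The inverse is a total function; its value at 0
-- is irrelevant (only its behaviour on nonzero elements is constrained).
record FiniteField (c ℓ : Level) : Set (Level.suc (c ⊔ ℓ)) where
  field
    commRing : CommutativeRing c ℓ
  open CommutativeRing commRing public
  field
    _⁻¹      : Carrier → Carrier
    1≉0      : ¬ (1# ≈ 0#)
    ⁻¹-inverse : ∀ x → ¬ (x ≈ 0#) → (x * (x ⁻¹)) ≈ 1#
    q        : ℕ
    enum     : Fin q → Carrier
    enum-surj : ∀ x → ∃ λ i → enum i ≈ x
    enum-inj  : ∀ i j → enum i ≈ enum j → i ≡ j

module FieldOps {c ℓ} (F : FiniteField c ℓ) where
  open FiniteField F

  pow : Carrier → ℕ → Carrier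
  pow x zero    = 1#
  pow x (suc k) = x * pow x k

  zpow : Carrier → ℤ → Carrier
  zpow x (+ k)      = pow x k
  zpow x -[1+ k ]   = pow (x ⁻¹) (suc k)

  -- Polynomials over the field as coefficient lists, lowest degree first.
  Poly : Set c
  Poly = List Carrier

  coeff : Poly → ℕ → Carrier
  coeff []       _       = 0#
  coeff (a ∷ p)  zero    = a
  coeff (a ∷ p)  (suc k) = coeff p k

  _+ₚ_ : Poly → Poly → Poly
  []      +ₚ q       = q
  (a ∷ p) +ₚ []      = a ∷ p
  (a ∷ p) +ₚ (b ∷ q) = (a + b) ∷ (p +ₚ q)

  scale : Carrier → Poly → Poly
  scale a []      = []
  scale a (b ∷ p) = (a * b) ∷ scale a p

  _*ₚ_ : Poly → Poly → Poly
  []      *ₚ q = []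
  (a ∷ p) *ₚ q = scale a q +ₚ (0# ∷ (p *ₚ q))

  _≈ₚ_ : Poly → Poly → Set ℓ
  p ≈ₚ q = ∀ k → coeff p k ≈ coeff q k

  monomial : ℕ → Carrier → Poly
  monomial k a = replicate k 0# ++ (a ∷ [])

  xPowMinus : ℕ → Carrier → Poly
  xPowMinus r β = monomial r 1# +ₚ ((- β) ∷ [])

  MonicOfDegree : Poly → ℕ → Set ℓ
  MonicOfDegree p n = (coeff p n ≈ 1#) × (∀ k → n ℕ.< k → coeff p k ≈ 0#)
    where open import Data.Product using (_×_)

  _∣ₚ_ : Poly → Poly → Set (c ⊔ ℓ)
  p ∣ₚ g = ∃ λ h → (p *ₚ h) ≈ₚ g

{-# OPTIONS --safe #-}
-- Write q - 1 = k r and β = γʳ.  Every unit a has (aʳ)ᵏ = a^(q-1) = 1 = γ^(q-1) = βᵏ, so it is a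
-- root of xʳ - β or of its cofactor in x^(kr) - βᵏ, which has degree (k - 1) r; as a polynomial
-- has at most as many roots as its degree, xʳ - β has r distinct roots.  The same count applied to
-- f · h = xʳ - β gives f at least n distinct roots y₁ … yₙ, all with yᵢʳ = β.  Hence
-- c₀ = (-1)ⁿ w with w = ∏ yᵢ and wʳ = βⁿ, and ((-1)^(nu) c₀ᵘ βᵛ)ʳ = (wᵘ βᵛ)ʳ = β^(nu + vr) = β.
module Submission where

open import Defs
open import Level using (Level)
open import Data.Nat using (ℕ; _<_; _∸_)
open import Data.Nat.Divisibility using (_∣_)
open import Data.Nat.Primality using (Prime)
open import Data.Integer as ℤ using (ℤ; +_)
open import Data.Product using (∃; _×_)
open import Relation.Binary.PropositionalEquality using (_≡_)
open import Relation.Nullary using (¬_)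

open import Data.Nat as ℕ using (zero; suc; z≤n; s≤s; _≤_)
import Data.Nat.Properties as ℕ
open import Data.Nat.Divisibility using (divides)
open import Data.Integer using (-[1+_])
import Data.Integer.Properties as ℤ
import Data.Fin as Fin
open import Data.Bool using (true; false)
open import Data.Product using (_,_; proj₁; proj₂)
open import Data.Sum using (_⊎_; inj₁; inj₂; [_,_])
open import Data.Empty using (⊥-elim)
open import Function using (_∘_; id)
open import Data.List using (List; []; _∷_; length; replicate; _++_; map; foldr; filter; tabulate; take)
open import Data.List.Properties using (length-map; length-tabulate; length-take; length-removeAt′)
open import Data.List.Relation.Unary.All as All using (All; []; _∷_)
open import Data.List.Relation.Unary.All.Properties using (all-filter)
import Data.List.Relation.Unary.All.Properties as All
open import Data.List.Relation.Unary.Any using (here; there)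
open import Data.List.Relation.Unary.AllPairs using ([]; _∷_)
open import Data.Maybe using (nothing)
import Relation.Binary.PropositionalEquality as ≡
open import Relation.Binary using (tri<; tri≈; tri>)
open import Relation.Binary.Definitions using (Decidable)
open import Relation.Nullary using (yes; no; does)
open import Relation.Unary using (Pred)
import Relation.Unary as U
open import Relation.Unary.Properties using (∁?)
open import Tactic.RingSolver.Core.AlmostCommutativeRing using (fromCommutativeRing)

length-filter-∁ : ∀ {a p} {A : Set a} {P : Pred A p} (P? : U.Decidable P) xs →
                  length (filter P? xs) ℕ.+ length (filter (∁? P?) xs) ≡ length xs
length-filter-∁ P? []       = ≡.refl
length-filter-∁ P? (x ∷ xs) with does (P? x)
... | true  = ≡.cong suc (length-filter-∁ P? xs)
... | false = ≡.trans (ℕ.+-suc _ _) (≡.cong suc (length-filter-∁ P? xs))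

m+n≤o+p⇒p≤n⇒m≤o : ∀ {m n o p} → m ℕ.+ n ≤ o ℕ.+ p → p ≤ n → m ≤ o
m+n≤o+p⇒p≤n⇒m≤o {m} {n} {o} m+n≤o+p p≤n = ℕ.+-cancelʳ-≤ n m o (ℕ.≤-trans m+n≤o+p (ℕ.+-monoʳ-≤ o p≤n))

module FieldProperties {c ℓ} (F : FiniteField c ℓ) where
  open FiniteField F
  open FieldOps F
  open import Relation.Binary.Reasoning.Setoid setoid
  open import Algebra.Properties.CommutativeSemigroup *-commutativeSemigroup using (interchange)
  open import Algebra.Properties.Ring ring using (-‿involutive; -0#≈0#; -1*x≈-x)
  open import Algebra.Properties.CommutativeSemiring.Exp commutativeSemiring
    using (_^_; ^-congˡ; ^-homo-*; ^-assocʳ; ^-distrib-*)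

  _≟_ : Decidable _≈_
  x ≟ y with enum-surj x | enum-surj y
  ... | i , eᵢ | j , eⱼ with i Fin.≟ j
  ... | yes ≡.refl = yes (trans (sym eᵢ) eⱼ)
  ... | no i≢j = no (λ x≈y → i≢j (enum-inj i j (trans eᵢ (trans x≈y (sym eⱼ)))))

  *-cancelˡ : ∀ {x y z} → x ≉ 0# → x * y ≈ x * z → y ≈ z
  *-cancelˡ {x} {y} {z} x≉0 xy≈xz = begin
    y                ≈⟨ *-identityˡ y ⟨
    1# * y           ≈⟨ *-congʳ (trans (*-comm _ _) (⁻¹-inverse x x≉0)) ⟨
    (x ⁻¹ * x) * y   ≈⟨ *-assoc _ _ _ ⟩
    x ⁻¹ * (x * y)   ≈⟨ *-congˡ xy≈xz ⟩
    x ⁻¹ * (x * z)   ≈⟨ *-assoc _ _ _ ⟨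
    (x ⁻¹ * x) * z   ≈⟨ *-congʳ (trans (*-comm _ _) (⁻¹-inverse x x≉0)) ⟩
    1# * z           ≈⟨ *-identityˡ z ⟩
    z                ∎

  zero-product : ∀ {x y} → x * y ≈ 0# → x ≈ 0# ⊎ y ≈ 0#
  zero-product {x} {y} xy≈0 with x ≟ 0#
  ... | yes x≈0 = inj₁ x≈0
  ... | no x≉0  = inj₂ (*-cancelˡ x≉0 (trans xy≈0 (sym (zeroʳ x))))

  *-nonzero : ∀ {x y} → x ≉ 0# → y ≉ 0# → x * y ≉ 0#
  *-nonzero x≉0 y≉0 xy≈0 = [ x≉0 , y≉0 ] (zero-product xy≈0)

  -- `pow` unfolds exactly like the library's `_^_`, so the laws of `_^_` transfer along `pow≡^`.

  pow≡^ : ∀ x n → pow x n ≡ x ^ n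
  pow≡^ x zero    = ≡.refl
  pow≡^ x (suc n) = ≡.cong (x *_) (pow≡^ x n)

  pow-congˡ : ∀ {x y} n → x ≈ y → pow x n ≈ pow y n
  pow-congˡ {x} {y} n x≈y rewrite pow≡^ x n | pow≡^ y n = ^-congˡ n x≈y

  pow-homo-* : ∀ x m n → pow x (m ℕ.+ n) ≈ pow x m * pow x n
  pow-homo-* x m n rewrite pow≡^ x (m ℕ.+ n) | pow≡^ x m | pow≡^ x n = ^-homo-* x m n

  pow-distrib-* : ∀ x y n → pow (x * y) n ≈ pow x n * pow y n
  pow-distrib-* x y n rewrite pow≡^ (x * y) n | pow≡^ x n | pow≡^ y n = ^-distrib-* x y n

  pow-assocʳ : ∀ x m n → pow (pow x m) n ≈ pow x (m ℕ.* n)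
  pow-assocʳ x m n rewrite pow≡^ (pow x m) n | pow≡^ x m | pow≡^ x (m ℕ.* n) = ^-assocʳ x m n

  pow-comm : ∀ x m n → pow (pow x m) n ≈ pow (pow x n) m
  pow-comm x m n = begin
    pow (pow x m) n  ≈⟨ pow-assocʳ x m n ⟩
    pow x (m ℕ.* n)  ≡⟨ ≡.cong (pow x) (ℕ.*-comm m n) ⟩
    pow x (n ℕ.* m)  ≈⟨ pow-assocʳ x n m ⟨
    pow (pow x n) m  ∎

  pow-one : ∀ n → pow 1# n ≈ 1#
  pow-one zero    = refl
  pow-one (suc n) = trans (*-identityˡ _) (pow-one n)

  pow-nonzero : ∀ {x} n → x ≉ 0# → pow x n ≉ 0#
  pow-nonzero zero    x≉0 = 1≉0
  pow-nonzero (suc n) x≉0 = *-nonzero x≉0 (pow-nonzero n x≉0)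

  ⁻¹-unique : ∀ {x y} → x ≉ 0# → x * y ≈ 1# → x ⁻¹ ≈ y
  ⁻¹-unique {x} x≉0 xy≈1 = *-cancelˡ x≉0 (trans (⁻¹-inverse x x≉0) (sym xy≈1))

  ⁻¹-cong : ∀ {x y} → x ≉ 0# → x ≈ y → x ⁻¹ ≈ y ⁻¹
  ⁻¹-cong {x} {y} x≉0 x≈y =
    sym (⁻¹-unique (λ y≈0 → x≉0 (trans x≈y y≈0)) (trans (*-congʳ (sym x≈y)) (⁻¹-inverse x x≉0)))

  ⁻¹-distrib-* : ∀ {x y} → x ≉ 0# → y ≉ 0# → (x * y) ⁻¹ ≈ x ⁻¹ * y ⁻¹
  ⁻¹-distrib-* {x} {y} x≉0 y≉0 = ⁻¹-unique (*-nonzero x≉0 y≉0) (begin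
    (x * y) * (x ⁻¹ * y ⁻¹)    ≈⟨ interchange x y (x ⁻¹) (y ⁻¹) ⟩
    (x * x ⁻¹) * (y * y ⁻¹)    ≈⟨ *-cong (⁻¹-inverse x x≉0) (⁻¹-inverse y y≉0) ⟩
    1# * 1#                    ≈⟨ *-identityˡ 1# ⟩
    1#                         ∎)

  ⁻¹-pow : ∀ {x} n → x ≉ 0# → pow x n ⁻¹ ≈ pow (x ⁻¹) n
  ⁻¹-pow {x} n x≉0 = ⁻¹-unique (pow-nonzero n x≉0) (begin
    pow x n * pow (x ⁻¹) n   ≈⟨ pow-distrib-* x (x ⁻¹) n ⟨
    pow (x * x ⁻¹) n         ≈⟨ pow-congˡ n (⁻¹-inverse x x≉0) ⟩
    pow 1# n                 ≈⟨ pow-one n ⟩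
    1#                       ∎)

  zpow-congˡ : ∀ {x y} z → x ≉ 0# → x ≈ y → zpow x z ≈ zpow y z
  zpow-congˡ (+ n)     x≉0 x≈y = pow-congˡ n x≈y
  zpow-congˡ -[1+ n ]  x≉0 x≈y = pow-congˡ (suc n) (⁻¹-cong x≉0 x≈y)

  zpow-distrib-* : ∀ {x y} z → x ≉ 0# → y ≉ 0# → zpow (x * y) z ≈ zpow x z * zpow y z
  zpow-distrib-* {x} {y} (+ n)    x≉0 y≉0 = pow-distrib-* x y n
  zpow-distrib-* {x} {y} -[1+ n ] x≉0 y≉0 =
    trans (pow-congˡ (suc n) (⁻¹-distrib-* x≉0 y≉0)) (pow-distrib-* _ _ (suc n))

  pow-zpow-comm : ∀ {x} z n → x ≉ 0# → pow (zpow x z) n ≈ zpow (pow x n) z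
  pow-zpow-comm {x} (+ m)    n x≉0 = pow-comm x m n
  pow-zpow-comm {x} -[1+ m ] n x≉0 =
    trans (pow-comm (x ⁻¹) (suc m) n) (pow-congˡ (suc m) (sym (⁻¹-pow n x≉0)))

  zpow-pow : ∀ {x} n z → x ≉ 0# → zpow x (+ n ℤ.* z) ≈ zpow (pow x n) z
  zpow-pow {x} n (+ m) x≉0 = begin
    zpow x (+ n ℤ.* + m)   ≡⟨ ≡.cong (zpow x) (ℤ.pos-* n m) ⟨
    pow x (n ℕ.* m)        ≈⟨ pow-assocʳ x n m ⟨
    pow (pow x n) m        ∎
  zpow-pow {x} n -[1+ m ] x≉0 = begin
    zpow x (+ n ℤ.* -[1+ m ])       ≡⟨ ≡.cong (zpow x) (ℤ.neg-distribʳ-* (+ n) (+ suc m)) ⟨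
    zpow x (ℤ.- (+ n ℤ.* + suc m))  ≡⟨ ≡.cong (λ k → zpow x (ℤ.- k)) (ℤ.pos-* n (suc m)) ⟨
    zpow x (ℤ.- + (n ℕ.* suc m))    ≡⟨ zpow-neg x (n ℕ.* suc m) ⟩
    pow (x ⁻¹) (n ℕ.* suc m)        ≈⟨ pow-assocʳ (x ⁻¹) n (suc m) ⟨
    pow (pow (x ⁻¹) n) (suc m)      ≈⟨ pow-congˡ (suc m) (⁻¹-pow n x≉0) ⟨
    pow (pow x n ⁻¹) (suc m)        ∎
    where
    zpow-neg : ∀ x k → zpow x (ℤ.- + k) ≡ pow (x ⁻¹) k
    zpow-neg x zero    = ≡.refl
    zpow-neg x (suc k) = ≡.refl

  zpow-⊖ : ∀ {x} m n → x ≉ 0# → zpow x (m ℤ.⊖ n) ≈ pow x m * pow (x ⁻¹) n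
  zpow-⊖ {x} m       zero    x≉0 = sym (*-identityʳ _)
  zpow-⊖ {x} zero    (suc n) x≉0 = sym (*-identityˡ _)
  zpow-⊖ {x} (suc m) (suc n) x≉0 = begin
    zpow x (suc m ℤ.⊖ suc n)                    ≡⟨ ≡.cong (zpow x) (ℤ.[1+m]⊖[1+n]≡m⊖n m n) ⟩
    zpow x (m ℤ.⊖ n)                            ≈⟨ zpow-⊖ m n x≉0 ⟩
    pow x m * pow (x ⁻¹) n                      ≈⟨ *-identityˡ _ ⟨
    1# * (pow x m * pow (x ⁻¹) n)               ≈⟨ *-congʳ (⁻¹-inverse x x≉0) ⟨
    (x * x ⁻¹) * (pow x m * pow (x ⁻¹) n)       ≈⟨ interchange _ _ _ _ ⟩
    (x * pow x m) * (x ⁻¹ * pow (x ⁻¹) n)       ∎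

  zpow-homo-+ : ∀ {x} y z → x ≉ 0# → zpow x (y ℤ.+ z) ≈ zpow x y * zpow x z
  zpow-homo-+ {x} (+ m)    (+ n)    x≉0 = pow-homo-* x m n
  zpow-homo-+ {x} (+ m)    -[1+ n ] x≉0 = zpow-⊖ m (suc n) x≉0
  zpow-homo-+ {x} -[1+ m ] (+ n)    x≉0 = trans (zpow-⊖ n (suc m) x≉0) (*-comm _ _)
  zpow-homo-+ {x} -[1+ m ] -[1+ n ] x≉0 = begin
    pow (x ⁻¹) (suc (suc (m ℕ.+ n)))   ≡⟨ ≡.cong (pow (x ⁻¹)) (ℕ.+-suc (suc m) n) ⟨
    pow (x ⁻¹) (suc m ℕ.+ suc n)       ≈⟨ pow-homo-* (x ⁻¹) (suc m) (suc n) ⟩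
    pow (x ⁻¹) (suc m) * pow (x ⁻¹) (suc n) ∎

  root-nonzero : ∀ {x β} r → 0 < r → pow x r ≈ β → β ≉ 0# → x ≉ 0#
  root-nonzero (suc r) _ xʳ≈β β≉0 x≈0 = β≉0 (trans (sym xʳ≈β) (trans (*-congʳ x≈0) (zeroˡ _)))

  -1≉0 : - 1# ≉ 0#
  -1≉0 -1≈0 = 1≉0 (trans (sym (-‿involutive 1#)) (trans (-‿cong -1≈0) -0#≈0#))

  [-1]ⁿ*[-1]ⁿ≈1 : ∀ n → pow (- 1#) n * pow (- 1#) n ≈ 1#
  [-1]ⁿ*[-1]ⁿ≈1 n = begin
    pow (- 1#) n * pow (- 1#) n   ≈⟨ pow-distrib-* _ _ n ⟨
    pow (- 1# * - 1#) n           ≈⟨ pow-congˡ n (trans (-1*x≈-x (- 1#)) (-‿involutive 1#)) ⟩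
    pow 1# n                      ≈⟨ pow-one n ⟩
    1#                            ∎

  zpow-signed : ∀ {c w} n u → w ≉ 0# → c ≈ pow (- 1#) n * w → zpow (- 1#) (+ n ℤ.* u) * zpow c u ≈ zpow w u
  zpow-signed {c} {w} n u w≉0 c≈±w = begin
    zpow (- 1#) (+ n ℤ.* u) * zpow c u   ≈⟨ *-congʳ (zpow-pow n u -1≉0) ⟩
    zpow s u * zpow c u                  ≈⟨ zpow-distrib-* u s≉0 c≉0 ⟨
    zpow (s * c) u                       ≈⟨ zpow-congˡ u (*-nonzero s≉0 c≉0) sc≈w ⟩
    zpow w u                             ∎
    where
    s = pow (- 1#) n
    s≉0 : s ≉ 0#
    s≉0 = pow-nonzero n -1≉0
    c≉0 : c ≉ 0#
    c≉0 c≈0 = *-nonzero s≉0 w≉0 (trans (sym c≈±w) c≈0)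
    sc≈w : s * c ≈ w
    sc≈w = begin
      s * c          ≈⟨ *-congˡ c≈±w ⟩
      s * (s * w)    ≈⟨ *-assoc _ _ _ ⟨
      (s * s) * w    ≈⟨ *-congʳ ([-1]ⁿ*[-1]ⁿ≈1 n) ⟩
      1# * w         ≈⟨ *-identityˡ w ⟩
      w              ∎

  bezout-root : ∀ {w β r n u v} → w ≉ 0# → β ≉ 0# → pow w r ≈ pow β n →
                u ℤ.* + n ℤ.+ v ℤ.* + r ≡ + 1 → pow (zpow w u * zpow β v) r ≈ β
  bezout-root {w} {β} {r} {n} {u} {v} w≉0 β≉0 wʳ≈βⁿ un+vr≡1 = begin
    pow (zpow w u * zpow β v) r               ≈⟨ pow-distrib-* _ _ r ⟩
    pow (zpow w u) r * pow (zpow β v) r       ≈⟨ *-cong (pow-zpow-comm u r w≉0) (pow-zpow-comm v r β≉0) ⟩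
    zpow (pow w r) u * zpow (pow β r) v       ≈⟨ *-congʳ (zpow-congˡ u (pow-nonzero r w≉0) wʳ≈βⁿ) ⟩
    zpow (pow β n) u * zpow (pow β r) v       ≈⟨ *-cong (zpow-pow n u β≉0) (zpow-pow r v β≉0) ⟨
    zpow β (+ n ℤ.* u) * zpow β (+ r ℤ.* v)   ≈⟨ zpow-homo-+ (+ n ℤ.* u) (+ r ℤ.* v) β≉0 ⟨
    zpow β (+ n ℤ.* u ℤ.+ + r ℤ.* v)          ≡⟨ ≡.cong (zpow β) nu+rv≡1 ⟩
    β * 1#                                    ≈⟨ *-identityʳ β ⟩
    β                                         ∎
    where
    nu+rv≡1 = ≡.trans (≡.cong₂ ℤ._+_ (ℤ.*-comm (+ n) u) (ℤ.*-comm (+ r) v)) un+vr≡1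

module Products {c ℓ} (F : FiniteField c ℓ) where
  open FiniteField F
  open FieldOps F
  open FieldProperties F
  open import Relation.Binary.Reasoning.Setoid setoid
  open import Algebra.Properties.CommutativeSemigroup *-commutativeSemigroup using (interchange; x∙yz≈y∙xz)
  open import Data.List.Membership.Setoid setoid using (_∈_; _─_)
  open import Data.List.Relation.Unary.Unique.Setoid setoid using (Unique)

  prod : List Carrier → Carrier
  prod = foldr _*_ 1#

  prod-nonzero : ∀ {xs} → All (_≉ 0#) xs → prod xs ≉ 0#
  prod-nonzero []          = 1≉0
  prod-nonzero (x≉0 ∷ xs≉0) = *-nonzero x≉0 (prod-nonzero xs≉0)

  pow-prod : ∀ {r β xs} → All (λ x → pow x r ≈ β) xs → pow (prod xs) r ≈ pow β (length xs)
  pow-prod {r} []                = pow-one r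
  pow-prod {r} (xʳ≈β ∷ xsʳ≈β) = trans (pow-distrib-* _ _ r) (*-cong xʳ≈β (pow-prod {r} xsʳ≈β))

  prod-map-* : ∀ a xs → prod (map (a *_) xs) ≈ pow a (length xs) * prod xs
  prod-map-* a []       = sym (*-identityˡ 1#)
  prod-map-* a (x ∷ xs) = trans (*-congˡ (prod-map-* a xs)) (interchange a x _ _)

  prod-─ : ∀ {x xs} (x∈xs : x ∈ xs) → prod xs ≈ x * prod (xs ─ x∈xs)
  prod-─ (here x≈y)   = *-congʳ (sym x≈y)
  prod-─ (there x∈xs) = trans (*-congˡ (prod-─ x∈xs)) (x∙yz≈y∙xz _ _ _)

  ∈-─ : ∀ {x y xs} (x∈xs : x ∈ xs) → y ∈ xs → y ≉ x → y ∈ xs ─ x∈xs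
  ∈-─ (here x≈z)   (here y≈z)   y≉x = ⊥-elim (y≉x (trans y≈z (sym x≈z)))
  ∈-─ (here _)     (there y∈xs) y≉x = y∈xs
  ∈-─ (there _)    (here y≈z)   y≉x = here y≈z
  ∈-─ (there x∈xs) (there y∈xs) y≉x = there (∈-─ x∈xs y∈xs y≉x)

  prod-⊆-length : ∀ {xs ys} → Unique xs → All (_∈ ys) xs → length xs ≡ length ys → prod xs ≈ prod ys
  prod-⊆-length {[]}     {[]}      _ _ _ = refl
  prod-⊆-length {x ∷ xs} {ys} (x∉xs ∷ xs!) (x∈ys ∷ xs⊆ys) |xs|≡|ys| = begin
    x * prod xs              ≈⟨ *-congˡ (prod-⊆-length xs! xs⊆ys─x lengths) ⟩
    x * prod (ys ─ x∈ys)     ≈⟨ prod-─ x∈ys ⟨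
    prod ys                  ∎
    where
    xs⊆ys─x = All.zipWith (λ (y∈ys , x≉y) → ∈-─ x∈ys y∈ys (λ y≈x → x≉y (sym y≈x))) (xs⊆ys , x∉xs)
    lengths = ℕ.suc-injective (≡.trans |xs|≡|ys| (length-removeAt′ ys _))

module Polynomials {c ℓ} (F : FiniteField c ℓ) where
  open FiniteField F
  open FieldOps F
  open FieldProperties F
  open Products F
  open import Relation.Binary.Reasoning.Setoid setoid
  open import Algebra.Properties.CommutativeSemigroup *-commutativeSemigroup using (interchange)
  open import Algebra.Properties.Ring ring
    using (-‿distribˡ-*; -1*x≈-x; +-inverseˡ-unique; //-rightDividesˡ; x∙y⁻¹≈ε⇒x≈y)
  open import Tactic.RingSolver.NonReflective (fromCommutativeRing commRing (λ _ → nothing))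
    using (solve; _⊜_; _⊕_; _⊗_)
  open import Data.List.Relation.Unary.Unique.Setoid setoid using (Unique)
  import Data.List.Relation.Unary.Unique.Setoid.Properties as Unique

  eval : Poly → Carrier → Carrier
  eval []      x = 0#
  eval (a ∷ p) x = a + x * eval p x

  IsRoot : Poly → Carrier → Set ℓ
  IsRoot p x = eval p x ≈ 0#

  coeff-+ₚ : ∀ p q k → coeff (p +ₚ q) k ≈ coeff p k + coeff q k
  coeff-+ₚ []      q       k       = sym (+-identityˡ _)
  coeff-+ₚ (a ∷ p) []      k       = sym (+-identityʳ _)
  coeff-+ₚ (a ∷ p) (b ∷ q) zero    = refl
  coeff-+ₚ (a ∷ p) (b ∷ q) (suc k) = coeff-+ₚ p q k

  coeff-scale : ∀ a p k → coeff (scale a p) k ≈ a * coeff p k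
  coeff-scale a []      k       = sym (zeroʳ a)
  coeff-scale a (b ∷ p) zero    = refl
  coeff-scale a (b ∷ p) (suc k) = coeff-scale a p k

  coeff-∷*ₚ : ∀ a p q k → coeff ((a ∷ p) *ₚ q) k ≈ a * coeff q k + coeff (0# ∷ (p *ₚ q)) k
  coeff-∷*ₚ a p q k = trans (coeff-+ₚ (scale a q) _ k) (+-congʳ (coeff-scale a q k))

  ∷-zero : ∀ {p} → p ≈ₚ [] → (0# ∷ p) ≈ₚ []
  ∷-zero p≈0 zero    = refl
  ∷-zero p≈0 (suc k) = p≈0 k

  *ₚ-zeroˡ : ∀ p q → p ≈ₚ [] → (p *ₚ q) ≈ₚ []
  *ₚ-zeroˡ []      q p≈0 k = refl
  *ₚ-zeroˡ (a ∷ p) q p≈0 k = begin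
    coeff ((a ∷ p) *ₚ q) k                  ≈⟨ coeff-∷*ₚ a p q k ⟩
    a * coeff q k + coeff (0# ∷ (p *ₚ q)) k ≈⟨ +-cong (*-congʳ (p≈0 0)) (∷-zero (*ₚ-zeroˡ p q (λ k → p≈0 (suc k))) k) ⟩
    0# * coeff q k + 0#                     ≈⟨ trans (+-identityʳ _) (zeroˡ _) ⟩
    0#                                      ∎

  *ₚ-zeroʳ : ∀ p q → q ≈ₚ [] → (p *ₚ q) ≈ₚ []
  *ₚ-zeroʳ []      q q≈0 k = refl
  *ₚ-zeroʳ (a ∷ p) q q≈0 k = begin
    coeff ((a ∷ p) *ₚ q) k                  ≈⟨ coeff-∷*ₚ a p q k ⟩
    a * coeff q k + coeff (0# ∷ (p *ₚ q)) k ≈⟨ +-cong (*-congˡ (q≈0 k)) (∷-zero (*ₚ-zeroʳ p q q≈0) k) ⟩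
    a * 0# + 0#                             ≈⟨ trans (+-identityʳ _) (zeroʳ _) ⟩
    0#                                      ∎

  eval-zero : ∀ p x → p ≈ₚ [] → eval p x ≈ 0#
  eval-zero []      x p≈0 = refl
  eval-zero (a ∷ p) x p≈0 = begin
    a + x * eval p x ≈⟨ +-cong (p≈0 0) (*-congˡ (eval-zero p x (λ k → p≈0 (suc k)))) ⟩
    0# + x * 0#      ≈⟨ trans (+-identityˡ _) (zeroʳ x) ⟩
    0#               ∎

  eval-cong : ∀ p q x → p ≈ₚ q → eval p x ≈ eval q x
  eval-cong []      q       x p≈q = sym (eval-zero q x (λ k → sym (p≈q k)))
  eval-cong (a ∷ p) []      x p≈q = eval-zero (a ∷ p) x p≈q
  eval-cong (a ∷ p) (b ∷ q) x p≈q = +-cong (p≈q 0) (*-congˡ (eval-cong p q x (λ k → p≈q (suc k))))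

  eval-+ₚ : ∀ p q x → eval (p +ₚ q) x ≈ eval p x + eval q x
  eval-+ₚ []      q       x = sym (+-identityˡ _)
  eval-+ₚ (a ∷ p) []      x = sym (+-identityʳ _)
  eval-+ₚ (a ∷ p) (b ∷ q) x = trans (+-congˡ (*-congˡ (eval-+ₚ p q x)))
    (solve 5 (λ a b x P Q → (a ⊕ b ⊕ x ⊗ (P ⊕ Q)) ⊜ ((a ⊕ x ⊗ P) ⊕ (b ⊕ x ⊗ Q))) refl a b x (eval p x) (eval q x))

  eval-scale : ∀ a p x → eval (scale a p) x ≈ a * eval p x
  eval-scale a []      x = sym (zeroʳ a)
  eval-scale a (b ∷ p) x = trans (+-congˡ (*-congˡ (eval-scale a p x)))
    (solve 4 (λ a b x P → (a ⊗ b ⊕ x ⊗ (a ⊗ P)) ⊜ (a ⊗ (b ⊕ x ⊗ P))) refl a b x (eval p x))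

  eval-*ₚ : ∀ p q x → eval (p *ₚ q) x ≈ eval p x * eval q x
  eval-*ₚ []      q x = sym (zeroˡ _)
  eval-*ₚ (a ∷ p) q x = begin
    eval (scale a q +ₚ (0# ∷ (p *ₚ q))) x           ≈⟨ eval-+ₚ (scale a q) _ x ⟩
    eval (scale a q) x + (0# + x * eval (p *ₚ q) x) ≈⟨ +-cong (eval-scale a q x) (trans (+-identityˡ _) (*-congˡ (eval-*ₚ p q x))) ⟩
    a * eval q x + x * (eval p x * eval q x)        ≈⟨ trans (distribʳ _ _ _) (+-congˡ (*-assoc _ _ _)) ⟨
    (a + x * eval p x) * eval q x                   ∎

  root-*ₚ : ∀ p q {x} → IsRoot (p *ₚ q) x → IsRoot p x ⊎ IsRoot q x
  root-*ₚ p q {x} pq[x]≈0 = zero-product (trans (sym (eval-*ₚ p q x)) pq[x]≈0)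

  -- With `a ≉ 0#`: `p` has degree `d` and leading coefficient `a`.  `MonicOfDegree p n` unfolds
  -- to `HasLeadingTerm p n 1#`.
  HasLeadingTerm : Poly → ℕ → Carrier → Set ℓ
  HasLeadingTerm p d a = coeff p d ≈ a × (∀ k → d < k → coeff p k ≈ 0#)

  leading-cong : ∀ p q {d a} → p ≈ₚ q → HasLeadingTerm p d a → HasLeadingTerm q d a
  leading-cong p q {d} p≈q (pd≈a , p>d≈0) = trans (sym (p≈q d)) pd≈a , λ k d<k → trans (sym (p≈q k)) (p>d≈0 k d<k)

  leading-∷ : ∀ {x p d a} → HasLeadingTerm p d a → HasLeadingTerm (x ∷ p) (suc d) a
  leading-∷ (pd≈a , p>d≈0) = pd≈a , λ { zero () ; (suc k) (s≤s d<k) → p>d≈0 k d<k }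

  leading-tail : ∀ {x p d a} → HasLeadingTerm (x ∷ p) (suc d) a → HasLeadingTerm p d a
  leading-tail (pd≈a , p>d≈0) = pd≈a , λ k d<k → p>d≈0 (suc k) (s≤s d<k)

  leading-constant-tail : ∀ {x p a} → HasLeadingTerm (x ∷ p) 0 a → p ≈ₚ []
  leading-constant-tail (_ , p>0≈0) k = p>0≈0 (suc k) (s≤s z≤n)

  leading-unique : ∀ p {d e a b} → HasLeadingTerm p d a → HasLeadingTerm p e b → a ≉ 0# → b ≉ 0# → d ≡ e
  leading-unique p {d} {e} (pd≈a , p>d≈0) (pe≈b , p>e≈0) a≉0 b≉0 with ℕ.<-cmp d e
  ... | tri< d<e _ _ = ⊥-elim (b≉0 (trans (sym pe≈b) (p>d≈0 e d<e)))
  ... | tri≈ _ d≡e _ = d≡e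
  ... | tri> _ _ e<d = ⊥-elim (a≉0 (trans (sym pd≈a) (p>e≈0 d e<d)))

  zero⊎leading : ∀ p → p ≈ₚ [] ⊎ ∃ λ d → ∃ λ a → a ≉ 0# × HasLeadingTerm p d a
  zero⊎leading []      = inj₁ (λ k → refl)
  zero⊎leading (x ∷ p) with zero⊎leading p
  ... | inj₂ (d , a , a≉0 , lead) = inj₂ (suc d , a , a≉0 , leading-∷ lead)
  ... | inj₁ p≈0 with x ≟ 0#
  ...   | yes x≈0 = inj₁ λ { zero → x≈0 ; (suc k) → p≈0 k }
  ...   | no x≉0  = inj₂ (0 , x , x≉0 , refl , λ { zero () ; (suc k) _ → p≈0 k })

  leading-*ₚ : ∀ p q {m n a b} → HasLeadingTerm p m a → HasLeadingTerm q n b →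
               HasLeadingTerm (p *ₚ q) (m ℕ.+ n) (a * b)
  leading-*ₚ []      q {b = b} (0≈a , _) _ = sym (trans (*-congʳ (sym 0≈a)) (zeroˡ b)) , λ _ _ → refl
  leading-*ₚ (x ∷ p) q {zero} {n} (x≈a , p>0≈0) (qn≈b , q>n≈0) =
    trans (x∷p*q≈x*q n) (*-cong x≈a qn≈b) ,
    λ k n<k → trans (x∷p*q≈x*q k) (trans (*-congˡ (q>n≈0 k n<k)) (zeroʳ x))
    where
    x∷p*q≈x*q : ∀ k → coeff ((x ∷ p) *ₚ q) k ≈ x * coeff q k
    x∷p*q≈x*q k = trans (coeff-∷*ₚ x p q k)
      (trans (+-congˡ (∷-zero (*ₚ-zeroˡ p q (leading-constant-tail (x≈a , p>0≈0))) k)) (+-identityʳ _))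
  leading-*ₚ (x ∷ p) q {suc m} {n} lead-p lead-q@(_ , q>n≈0) =
    trans (x∷p*q≈p*q ℕ.≤-refl) (proj₁ IH) ,
    λ { zero () ; (suc k) (s≤s m+n<k) → trans (x∷p*q≈p*q (ℕ.<⇒≤ m+n<k)) (proj₂ IH k m+n<k) }
    where
    IH = leading-*ₚ p q (leading-tail lead-p) lead-q
    x∷p*q≈p*q : ∀ {k} → m ℕ.+ n ≤ k → coeff ((x ∷ p) *ₚ q) (suc k) ≈ coeff (p *ₚ q) k
    x∷p*q≈p*q {k} m+n≤k = trans (coeff-∷*ₚ x p q (suc k)) (trans
      (+-congʳ (trans (*-congˡ (q>n≈0 (suc k) (s≤s (ℕ.≤-trans (ℕ.m≤n+m n m) m+n≤k)))) (zeroʳ x)))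
      (+-identityˡ _))

  eval-leading-constant : ∀ p {a} x → HasLeadingTerm p 0 a → eval p x ≈ a
  eval-leading-constant []      x (0≈a , _) = 0≈a
  eval-leading-constant (y ∷ p) {a} x lead@(y≈a , _) = begin
    y + x * eval p x ≈⟨ +-cong y≈a (*-congˡ (eval-zero p x (leading-constant-tail lead))) ⟩
    a + x * 0#       ≈⟨ trans (+-congˡ (zeroʳ x)) (+-identityʳ a) ⟩
    a                ∎

  eval-[_] : ∀ a x → eval (a ∷ []) x ≈ a
  eval-[ a ] x = trans (+-congˡ (zeroʳ x)) (+-identityʳ a)

  shift : ℕ → Poly → Poly
  shift k p = replicate k 0# ++ p

  eval-shift : ∀ k p x → eval (shift k p) x ≈ pow x k * eval p x
  eval-shift zero    p x = sym (*-identityˡ _)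
  eval-shift (suc k) p x = trans (+-identityˡ _) (trans (*-congˡ (eval-shift k p x)) (sym (*-assoc _ _ _)))

  leading-shift : ∀ k {p d a} → HasLeadingTerm p d a → HasLeadingTerm (shift k p) (k ℕ.+ d) a
  leading-shift zero    lead = lead
  leading-shift (suc k) lead = leading-∷ (leading-shift k lead)

  leading-monomial : ∀ k a → HasLeadingTerm (monomial k a) k a
  leading-monomial zero    a = refl , λ { zero () ; (suc k) _ → refl }
  leading-monomial (suc k) a = leading-∷ (leading-monomial k a)

  leading-xPowMinus : ∀ {r} β → 0 < r → HasLeadingTerm (xPowMinus r β) r 1#
  leading-xPowMinus {suc r} β _ =
    trans (xPowMinus≈monomial r) (proj₁ lead) ,
    λ { zero () ; (suc k) r<k → trans (xPowMinus≈monomial k) (proj₂ lead (suc k) r<k) }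
    where
    lead = leading-monomial (suc r) 1#
    xPowMinus≈monomial : ∀ k → coeff (xPowMinus (suc r) β) (suc k) ≈ coeff (monomial (suc r) 1#) (suc k)
    xPowMinus≈monomial k = trans (coeff-+ₚ (monomial (suc r) 1#) (- β ∷ []) (suc k)) (+-identityʳ _)

  eval-xPowMinus : ∀ r β x → eval (xPowMinus r β) x ≈ pow x r - β
  eval-xPowMinus r β x = trans (eval-+ₚ (monomial r 1#) _ x)
    (+-cong (trans (eval-shift r (1# ∷ []) x) (trans (*-congˡ (eval-[ 1# ] x)) (*-identityʳ _))) (eval-[ - β ] x))

  root-xPowMinus⁺ : ∀ {r β x} → pow x r ≈ β → IsRoot (xPowMinus r β) x
  root-xPowMinus⁺ {r} {β} {x} xʳ≈β = trans (eval-xPowMinus r β x) (trans (+-congʳ xʳ≈β) (-‿inverseʳ β))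

  root-xPowMinus⁻ : ∀ {r β x} → IsRoot (xPowMinus r β) x → pow x r ≈ β
  root-xPowMinus⁻ {r} {β} {x} root = x∙y⁻¹≈ε⇒x≈y _ _ (trans (sym (eval-xPowMinus r β x)) root)

  -- Synthetic division: the quotient of `p` by `x - a`.
  divLinear : Carrier → Poly → Poly
  divLinear a []      = []
  divLinear a (_ ∷ p) = eval p a ∷ divLinear a p

  -- Writing b as d + a turns the step into a ring identity in independent variables, which `solve`
  -- can check (it cannot cancel b - a + a by itself).
  remainder-theorem : ∀ a b p → eval p b ≈ (b - a) * eval (divLinear a p) b + eval p a
  remainder-theorem a b []       = sym (trans (+-identityʳ _) (zeroʳ _))
  remainder-theorem a b (c₀ ∷ p) = begin
    c₀ + b * eval p b                          ≈⟨ +-congˡ (*-congˡ (remainder-theorem a b p)) ⟩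
    c₀ + b * (d * Q + E)                       ≈⟨ +-congˡ (*-congʳ b≈d+a) ⟩
    c₀ + (d + a) * (d * Q + E)                 ≈⟨ solve 5 (λ c₀ a d Q E → (c₀ ⊕ (d ⊕ a) ⊗ (d ⊗ Q ⊕ E)) ⊜ (d ⊗ (E ⊕ (d ⊕ a) ⊗ Q) ⊕ (c₀ ⊕ a ⊗ E))) refl c₀ a d Q E ⟩
    d * (E + (d + a) * Q) + (c₀ + a * E)       ≈⟨ +-congʳ (*-congˡ (+-congˡ (*-congʳ b≈d+a))) ⟨
    d * (E + b * Q) + (c₀ + a * E)             ∎
    where
    d = b - a
    E = eval p a
    Q = eval (divLinear a p) b
    b≈d+a : b ≈ d + a
    b≈d+a = sym (//-rightDividesˡ a b)

  divLinear-root : ∀ p {a b} → IsRoot p a → IsRoot p b → a ≉ b → IsRoot (divLinear a p) b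
  divLinear-root p {a} {b} pa≈0 pb≈0 a≉b with zero-product (begin
      (b - a) * eval (divLinear a p) b          ≈⟨ +-identityʳ _ ⟨
      (b - a) * eval (divLinear a p) b + 0#     ≈⟨ +-congˡ pa≈0 ⟨
      (b - a) * eval (divLinear a p) b + eval p a ≈⟨ remainder-theorem a b p ⟨
      eval p b                                  ≈⟨ pb≈0 ⟩
      0#                                        ∎)
  ... | inj₁ b-a≈0 = ⊥-elim (a≉b (sym (x∙y⁻¹≈ε⇒x≈y b a b-a≈0)))
  ... | inj₂ q[b]≈0 = q[b]≈0

  divLinear-roots : ∀ p {a ys} → IsRoot p a → All (a ≉_) ys → All (IsRoot p) ys → All (IsRoot (divLinear a p)) ys
  divLinear-roots p pa≈0 a∉ys ys-roots =
    All.zipWith (λ (py≈0 , a≉y) → divLinear-root p pa≈0 py≈0 a≉y) (ys-roots , a∉ys)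

  divLinear-zero : ∀ a p → (∀ k → coeff p (suc k) ≈ 0#) → divLinear a p ≈ₚ []
  divLinear-zero a []      _      k       = refl
  divLinear-zero a (_ ∷ p) p'≈0 zero    = eval-zero p a p'≈0
  divLinear-zero a (_ ∷ p) p'≈0 (suc k) = divLinear-zero a p (λ k → p'≈0 (suc k)) k

  divLinear-leading : ∀ a p d {c} → HasLeadingTerm p (suc d) c → HasLeadingTerm (divLinear a p) d c
  divLinear-leading a []      d       (0≈c , _) = 0≈c , λ _ _ → refl
  divLinear-leading a (x ∷ p) zero    lead      =
    eval-leading-constant p a lead-p ,
    λ { zero () ; (suc k) _ → divLinear-zero a p (λ k → proj₂ lead-p (suc k) (s≤s z≤n)) k }
    where lead-p = leading-tail {x} {p} lead
  divLinear-leading a (x ∷ p) (suc d) lead      = leading-∷ (divLinear-leading a p d (leading-tail lead))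

  coeff₀-divLinear : ∀ p {a} → IsRoot p a → coeff p 0 ≈ - a * coeff (divLinear a p) 0
  coeff₀-divLinear []      _     = sym (zeroʳ _)
  coeff₀-divLinear (x ∷ p) {a} pa≈0 = trans (+-inverseˡ-unique x (a * eval p a) pa≈0) (-‿distribˡ-* a _)

  roots≤degree : ∀ p {d c xs} → HasLeadingTerm p d c → c ≉ 0# → Unique xs → All (IsRoot p) xs → length xs ≤ d
  roots≤degree p {xs = []} _ _ _ _ = z≤n
  roots≤degree p {d = zero} {xs = x ∷ _} lead c≉0 _ (px≈0 ∷ _) =
    ⊥-elim (c≉0 (trans (sym (eval-leading-constant p x lead)) px≈0))
  roots≤degree p {suc d} {xs = x ∷ _} lead c≉0 (x∉xs ∷ xs!) (px≈0 ∷ pxs≈0) =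
    s≤s (roots≤degree (divLinear x p) (divLinear-leading x p d lead) c≉0 xs! (divLinear-roots p px≈0 x∉xs pxs≈0))

  coeff₀-roots : ∀ p {n xs} → HasLeadingTerm p n 1# → Unique xs → All (IsRoot p) xs → length xs ≡ n →
                 coeff p 0 ≈ pow (- 1#) n * prod xs
  coeff₀-roots p {n = zero} {[]} lead _ _ _ = trans (proj₁ lead) (sym (*-identityˡ 1#))
  coeff₀-roots p {suc n} {x ∷ xs} lead (x∉xs ∷ xs!) (px≈0 ∷ pxs≈0) ≡.refl = begin
    coeff p 0                                     ≈⟨ coeff₀-divLinear p px≈0 ⟩
    - x * coeff (divLinear x p) 0                 ≈⟨ *-cong (-1*x≈-x x) (sym IH) ⟨
    (- 1# * x) * (pow (- 1#) n * prod xs)         ≈⟨ interchange _ _ _ _ ⟩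
    (- 1# * pow (- 1#) n) * (x * prod xs)         ∎
    where
    IH = coeff₀-roots (divLinear x p) (divLinear-leading x p n lead) xs! (divLinear-roots p px≈0 x∉xs pxs≈0) ≡.refl

  cofactor-degree : ∀ f h {g n d} → HasLeadingTerm f n 1# → (f *ₚ h) ≈ₚ g → HasLeadingTerm g d 1# →
                    ∃ λ m → ∃ λ b → b ≉ 0# × HasLeadingTerm h m b × n ℕ.+ m ≡ d
  cofactor-degree f h {g} {d = d} lead-f fh≈g lead-g with zero⊎leading h
  ... | inj₁ h≈0 = ⊥-elim (1≉0 (trans (sym (proj₁ lead-g)) (trans (sym (fh≈g d)) (*ₚ-zeroʳ f h h≈0 d))))
  ... | inj₂ (m , b , b≉0 , lead-h) = m , b , b≉0 , lead-h ,
    leading-unique g (leading-cong (f *ₚ h) g fh≈g (leading-*ₚ f h lead-f lead-h)) lead-g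
      (λ 1b≈0 → b≉0 (trans (sym (*-identityˡ b)) 1b≈0)) 1≉0

  factor-roots : ∀ f h {g m b n xs} → (f *ₚ h) ≈ₚ g → HasLeadingTerm h m b → b ≉ 0# →
                 Unique xs → All (IsRoot g) xs → n ℕ.+ m ≤ length xs →
                 ∃ λ ys → Unique ys × All (IsRoot f) ys × All (IsRoot g) ys × length ys ≡ n
  factor-roots f h {g} {m} {n = n} {xs} fh≈g lead-h b≉0 xs! xs-roots n+m≤|xs| =
    take n f-roots ,
    Unique.take⁺ setoid n (Unique.filter⁺ setoid isRoot? xs!) ,
    All.take⁺ n (all-filter isRoot? xs) ,
    All.take⁺ n (All.filter⁺ isRoot? xs-roots) ,
    ≡.trans (length-take n f-roots) (ℕ.m≤n⇒m⊓n≡m n≤|f-roots|)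
    where
    isRoot? : U.Decidable (IsRoot f)
    isRoot? x = eval f x ≟ 0#
    f-roots = filter isRoot? xs
    h-roots = filter (∁? isRoot?) xs
    h-roots-roots : All (IsRoot h) h-roots
    h-roots-roots = All.zipWith
      (λ { {x} (gx≈0 , fx≉0) → [ ⊥-elim ∘ fx≉0 , id ] (root-*ₚ f h (trans (eval-cong (f *ₚ h) g x fh≈g) gx≈0)) })
      (All.filter⁺ (∁? isRoot?) xs-roots , all-filter (∁? isRoot?) xs)
    |h-roots|≤m : length h-roots ≤ m
    |h-roots|≤m = roots≤degree h lead-h b≉0 (Unique.filter⁺ setoid (∁? isRoot?) xs!) h-roots-roots
    n≤|f-roots| : n ≤ length f-roots
    n≤|f-roots| = m+n≤o+p⇒p≤n⇒m≤o
      (ℕ.≤-trans n+m≤|xs| (ℕ.≤-reflexive (≡.sym (length-filter-∁ isRoot? xs)))) |h-roots|≤m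

module Units {c ℓ} (F : FiniteField c ℓ) where
  open FiniteField F
  open FieldOps F
  open FieldProperties F
  open Products F
  open Polynomials F
  open import Relation.Binary.Reasoning.Setoid setoid
  open import Data.List.Membership.Setoid setoid using (_∈_)
  open import Data.List.Membership.Setoid.Properties using (∈-tabulate⁺; ∈-filter⁺; ∈-resp-≈)
  open import Data.List.Relation.Unary.Unique.Setoid setoid using (Unique)
  import Data.List.Relation.Unary.Unique.Setoid.Properties as Unique

  ∈-enumeration : ∀ x → x ∈ tabulate enum
  ∈-enumeration x = ∈-resp-≈ setoid (proj₂ (enum-surj x)) (∈-tabulate⁺ setoid (proj₁ (enum-surj x)))

  units : List Carrier
  units = filter (∁? (_≟ 0#)) (tabulate enum)

  units-unique : Unique units
  units-unique = Unique.filter⁺ setoid (∁? (_≟ 0#)) (Unique.tabulate⁺ setoid (enum-inj _ _))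

  units-nonzero : All (_≉ 0#) units
  units-nonzero = all-filter (∁? (_≟ 0#)) (tabulate enum)

  ∈-units : ∀ {x} → x ≉ 0# → x ∈ units
  ∈-units {x} x≉0 = ∈-filter⁺ setoid (∁? (_≟ 0#)) (λ x≈y x≉0 y≈0 → x≉0 (trans x≈y y≈0))
    (∈-enumeration x) x≉0

  length-units : suc (length units) ≡ q
  length-units = ≡.trans (≡.cong (ℕ._+ length units) (≡.sym one-zero))
    (≡.trans (length-filter-∁ (_≟ 0#) (tabulate enum)) (length-tabulate enum))
    where
    zeros = filter (_≟ 0#) (tabulate enum)
    length≡1 : ∀ {xs} → Unique xs → All (_≈ 0#) xs → 0# ∈ xs → length xs ≡ 1
    length≡1 {_ ∷ []}    _                 _                 _ = ≡.refl
    length≡1 {_ ∷ _ ∷ _} ((x≉y ∷ _) ∷ _) (x≈0 ∷ y≈0 ∷ _) _ = ⊥-elim (x≉y (trans x≈0 (sym y≈0)))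
    one-zero : length zeros ≡ 1
    one-zero = length≡1 (Unique.filter⁺ setoid (_≟ 0#) (Unique.tabulate⁺ setoid (enum-inj _ _)))
      (all-filter (_≟ 0#) (tabulate enum))
      (∈-filter⁺ setoid (_≟ 0#) (λ x≈y x≈0 → trans (sym x≈y) x≈0) (∈-enumeration 0#) refl)

  fermat : ∀ {a} → a ≉ 0# → pow a (length units) ≈ 1#
  fermat {a} a≉0 = *-cancelˡ (prod-nonzero units-nonzero) (begin
    prod units * pow a (length units)   ≈⟨ *-comm _ _ ⟩
    pow a (length units) * prod units   ≈⟨ prod-map-* a units ⟨
    prod (map (a *_) units)             ≈⟨ prod-⊆-length a*units-unique a*units⊆units (length-map _ units) ⟩
    prod units                          ≈⟨ *-identityʳ _ ⟨
    prod units * 1#                     ∎)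
    where
    a*units-unique = Unique.map⁺ setoid setoid (*-cancelˡ a≉0) units-unique
    a*units⊆units = All.map⁺ (All.map (λ x≉0 → ∈-units (*-nonzero a≉0 x≉0)) units-nonzero)

module RthRoots {c ℓ} (F : FiniteField c ℓ) where
  open FiniteField F
  open FieldOps F
  open FieldProperties F
  open Polynomials F
  open Units F
  open import Relation.Binary.Reasoning.Setoid setoid
  open import Algebra.Properties.Ring ring using (+-cancelʳ)
  open import Tactic.RingSolver.NonReflective (fromCommutativeRing commRing (λ _ → nothing))
    using (solve; _⊜_; _⊕_; _⊗_)
  open import Data.List.Membership.Setoid.Properties using (∈-length)
  open import Data.List.Relation.Unary.Unique.Setoid setoid using (Unique)
  import Data.List.Relation.Unary.Unique.Setoid.Properties as Unique

  -- `geomₚ r' β j` is  Σ_{i ≤ j} β^(j-i) x^(i r)  for r = suc r', the cofactor of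
  -- xʳ - β in x^((j+1) r) - β^(j+1).
  geomₚ : ℕ → Carrier → ℕ → Poly
  geomₚ r' β zero    = 1# ∷ []
  geomₚ r' β (suc j) = pow β (suc j) ∷ shift r' (geomₚ r' β j)

  leading-geomₚ : ∀ r' β j → HasLeadingTerm (geomₚ r' β j) (j ℕ.* suc r') 1#
  leading-geomₚ r' β zero    = refl , λ { zero () ; (suc k) _ → refl }
  leading-geomₚ r' β (suc j) = leading-∷ (leading-shift r' (leading-geomₚ r' β j))

  -- (xʳ - β) · geomₚ = x^((j+1) r) - β^(j+1), rearranged so that no subtraction occurs.
  eval-geomₚ : ∀ r' β j x → let A = pow x (suc r'); G = eval (geomₚ r' β j) x in
               A * G + pow β (suc j) ≈ pow A (suc j) + β * G
  eval-geomₚ r' β zero x =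
    trans (+-congʳ (*-congˡ (eval-[ 1# ] x))) (+-congˡ (*-congˡ (sym (eval-[ 1# ] x))))
  eval-geomₚ r' β (suc j) x = begin
    A * G' + β * B                  ≈⟨ +-congʳ (*-congˡ (trans G'≈B+AG (+-comm _ _))) ⟩
    A * (A * G + B) + β * B         ≈⟨ +-congʳ (*-congˡ (eval-geomₚ r' β j x)) ⟩
    A * (pow A (suc j) + β * G) + β * B
      ≈⟨ solve 5 (λ A A₁ β B G → (A ⊗ (A₁ ⊕ β ⊗ G) ⊕ β ⊗ B) ⊜ (A ⊗ A₁ ⊕ β ⊗ (B ⊕ A ⊗ G))) refl A (pow A (suc j)) β B G ⟩
    A * pow A (suc j) + β * (B + A * G) ≈⟨ +-congˡ (*-congˡ G'≈B+AG) ⟨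
    A * pow A (suc j) + β * G'      ∎
    where
    A = pow x (suc r')
    B = pow β (suc j)
    G = eval (geomₚ r' β j) x
    G' = eval (geomₚ r' β (suc j)) x
    G'≈B+AG : G' ≈ B + A * G
    G'≈B+AG = +-congˡ (trans (*-congˡ (eval-shift r' _ x)) (sym (*-assoc _ _ _)))

  root-geomₚ : ∀ {r' β j x} → pow (pow x (suc r')) (suc j) ≈ pow β (suc j) → pow x (suc r') ≉ β →
               IsRoot (geomₚ r' β j) x
  root-geomₚ {r'} {β} {j} {x} Aʲ⁺¹≈βʲ⁺¹ A≉β with eval (geomₚ r' β j) x ≟ 0#
  ... | yes G≈0 = G≈0
  ... | no  G≉0 = ⊥-elim (A≉β (*-cancelˡ G≉0 (trans (*-comm _ _) (trans AG≈βG (*-comm _ _)))))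
    where
    A = pow x (suc r')
    B = pow β (suc j)
    G = eval (geomₚ r' β j) x
    AG≈βG : A * G ≈ β * G
    AG≈βG = +-cancelʳ B (A * G) (β * G) (begin
      A * G + B                  ≈⟨ eval-geomₚ r' β j x ⟩
      pow A (suc j) + β * G      ≈⟨ +-congʳ Aʲ⁺¹≈βʲ⁺¹ ⟩
      B + β * G                  ≈⟨ +-comm _ _ ⟩
      β * G + B                  ∎)

  rth-roots : ∀ {r β} → 0 < r → r ∣ length units → β ≉ 0# → (∃ λ γ → pow γ r ≈ β) →
              ∃ λ xs → Unique xs × All (λ x → pow x r ≈ β) xs × r ≤ length xs
  rth-roots {suc r'} _ (divides zero |units|≡0) _ _ =
    ⊥-elim (ℕ.<-irrefl (≡.sym |units|≡0) (∈-length setoid (∈-units 1≉0)))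
  rth-roots {suc r'} {β} _ (divides (suc j) |units|≡[1+j]r) β≉0 (γ , γʳ≈β) =
    roots , Unique.filter⁺ setoid isRth? units-unique , all-filter isRth? units ,
    m+n≤o+p⇒p≤n⇒m≤o (ℕ.≤-reflexive r+jr≡|roots|+|others|) |others|≤jr
    where
    r = suc r'
    isRth? : U.Decidable (λ x → pow x r ≈ β)
    isRth? x = pow x r ≟ β
    roots = filter isRth? units
    others = filter (∁? isRth?) units
    [xʳ]ʲ⁺¹≈xᴺ : ∀ x → pow (pow x r) (suc j) ≈ pow x (length units)
    [xʳ]ʲ⁺¹≈xᴺ x = trans (pow-assocʳ x r (suc j)) (reflexive (≡.cong (pow x) (≡.trans (ℕ.*-comm r (suc j)) (≡.sym |units|≡[1+j]r))))
    γ≉0 : γ ≉ 0#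
    γ≉0 = root-nonzero r (s≤s z≤n) γʳ≈β β≉0
    βʲ⁺¹≈1 : pow β (suc j) ≈ 1#
    βʲ⁺¹≈1 = trans (pow-congˡ (suc j) (sym γʳ≈β)) (trans ([xʳ]ʲ⁺¹≈xᴺ γ) (fermat γ≉0))
    others-roots : All (IsRoot (geomₚ r' β j)) others
    others-roots = All.zipWith
      (λ { {x} (x≉0 , xʳ≉β) → root-geomₚ {r'} {β} {j} (trans ([xʳ]ʲ⁺¹≈xᴺ x) (trans (fermat x≉0) (sym βʲ⁺¹≈1))) xʳ≉β })
      (All.filter⁺ (∁? isRth?) units-nonzero , all-filter (∁? isRth?) units)
    |others|≤jr : length others ≤ j ℕ.* r
    |others|≤jr = roots≤degree (geomₚ r' β j) (leading-geomₚ r' β j) 1≉0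
      (Unique.filter⁺ setoid (∁? isRth?) units-unique) others-roots
    r+jr≡|roots|+|others| : r ℕ.+ j ℕ.* r ≡ length roots ℕ.+ length others
    r+jr≡|roots|+|others| = ≡.sym (≡.trans (length-filter-∁ isRth? units) |units|≡[1+j]r)

lemma3p1 : ∀ {c ℓ : Level} (F : FiniteField c ℓ) →
    let open FiniteField F in
    let open FieldOps F in
    (r : ℕ) → Prime r → r ∣ (q ∸ 1) →
    (β : Carrier) → ¬ (β ≈ 0#) → (∃ λ γ → pow γ r ≈ β) →
    (f : Poly) (n : ℕ) → MonicOfDegree f n → 0 < n → n < r →
    f ∣ₚ xPowMinus r β →
    (u v : ℤ) → (u ℤ.* + n) ℤ.+ (v ℤ.* + r) ≡ + 1 →
    pow (zpow (- 1#) (+ n ℤ.* u) * zpow (coeff f 0) u * zpow β v) r ≈ β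
lemma3p1 F r _ r∣q∸1 β β≉0 β-rth-power f n monic-f 0<n n<r (h , fh≈g) u v un+vr≡1 =
  let m , b , b≉0 , lead-h , n+m≡r = cofactor-degree f h {xPowMinus r β} monic-f fh≈g (leading-xPowMinus β 0<r)
      xs , xs! , xsʳ≈β , r≤|xs| = rth-roots {r} {β} 0<r r∣|units| β≉0 β-rth-power
      ys , ys! , f[ys]≈0 , g[ys]≈0 , |ys|≡n = factor-roots f h {xPowMinus r β} fh≈g lead-h b≉0 xs!
        (All.map (root-xPowMinus⁺ {r} {β}) xsʳ≈β) (ℕ.≤-trans (ℕ.≤-reflexive n+m≡r) r≤|xs|)
      ysʳ≈β = All.map (root-xPowMinus⁻ {r} {β}) g[ys]≈0
      w≉0 = prod-nonzero (All.map (λ yʳ≈β → root-nonzero r 0<r yʳ≈β β≉0) ysʳ≈β)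
      c₀≈±w = coeff₀-roots f monic-f ys! f[ys]≈0 |ys|≡n
      wʳ≈βⁿ = trans (pow-prod {r} ysʳ≈β) (reflexive (≡.cong (pow β) |ys|≡n))
  in trans (pow-congˡ r (*-congʳ (zpow-signed n u w≉0 c₀≈±w))) (bezout-root {r = r} {n} {u} {v} w≉0 β≉0 wʳ≈βⁿ un+vr≡1)
  where
  open FiniteField F
  open FieldOps F
  open FieldProperties F
  open Products F
  open Polynomials F
  open Units F
  open RthRoots F
  0<r = ℕ.<-trans 0<n n<r
  r∣|units| : r ∣ length units
  r∣|units| = ≡.subst (r ∣_) (≡.cong (_∸ 1) (≡.sym length-units)) r∣q∸1
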